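{- Let $r\geq3$ be an even integer and, in the prism $\Pr_r$ (indices mod $r$), define the Hamilton circuits $H_{\mathrm{w},1}=x_0x_1y_1y_2x_2x_3\dots x_{r-1}y_{r-1}y_0x_0$, $H_{\mathrm{w},2}=y_0y_1x_1x_2y_2y_3\dots y_{r-1}x_{r-1}x_0y_0$, and for each $i$, $H_i=x_ix_{i+1}\dots x_{i+r-1}y_{i+r-1}y_{i+r-2}\dots y_ix_i$. Let $\mathrm{C}_{r,1}=x_0x_1\dots x_{r-1}x_0$, $\mathrm{C}_{r,2}=y_0\dots y_{r-1}y_0$ and $\mathrm{C}_{4,i}=x_ix_{i+1}y_{i+1}y_ix_i$. Then every non-separating induced circuit of $\Pr_r$ is a symmetric difference of some circuits among $\{H_{\mathrm{w},1},H_{\mathrm{w},2}\}\cup\{H_i:0\leq i\leq r-1\}$; explicitly, for every $0\leq i\leq r-1$, $\mathrm{c}_{\mathrm{C}_{4,i}}=\mathrm{c}_{H_{\mathrm{w},1}}+\mathrm{c}_{H_{\mathrm{w},2}}+\mathrm{c}_{H_{i+1}}$, and with $\Sigma=\sum_{0\leq i\leq r/2-1}\mathrm{c}_{H_{2i}}$: if $r\equiv0\pmod4$ then $\mathrm{c}_{\mathrm{C}_{r,1}}=\mathrm{c}_{H_{\mathrm{w},1}}+\Sigma$ and $\mathrm{c}_{\mathrm{C}_{r,2}}=\mathrm{c}_{H_{\mathrm{w},2}}+\Sigma$, while if $r\equiv2\pmod4$ then $\mathrm{c}_{\mathrm{C}_{r,1}}=\mathrm{c}_{H_{\mathrm{w},2}}+\Sigma$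 and $\mathrm{c}_{\mathrm{C}_{r,2}}=\mathrm{c}_{H_{\mathrm{w},1}}+\Sigma$.
   Context: The prism $\Pr_r$ has vertices $x_0,\dots,x_{r-1},y_0,\dots,y_{r-1}$ and edges $x_ix_{i+1}$, $y_iy_{i+1}$, $x_iy_i$ ($0\leq i\leq r-1$, indices mod $r$). A circuit $v_0v_1\dots v_{\ell-1}v_0$ has edges $v_0v_1,\dots,v_{\ell-1}v_0$. For a circuit $C$, $\mathrm{c}_C\in\mathrm{C}_1(\Pr_r;\mathbb{Z}/2)$ is the 1-chain over $\mathbb{Z}/2$ whose support is the edge set of $C$. A circuit is non-separating induced if deleting its vertices leaves a connected graph and it has no chords. The non-separating induced circuits of $\Pr_r$ ($r\geq4$) are exactly $\mathrm{C}_{r,1}$, $\mathrm{C}_{r,2}$ and the $\mathrm{C}_{4,i}$. -}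

module Defs where

open import Data.Bool using (Bool; true; false; _xor_; if_then_else_)
open import Data.Nat using (ℕ; zero; suc; _+_; _*_; _∸_; NonZero)
open import Data.Nat.DivMod using (_mod_)
open import Data.Fin using (Fin)
import Data.Fin.Properties as FinP
open import Data.List using (List; []; _∷_; _++_; map; concatMap; foldr; upTo; reverse; zip)
open import Data.Product using (_×_; _,_)
open import Data.Product.Properties using (≡-dec)
open import Relation.Binary.PropositionalEquality using (_≡_; refl)
open import Relation.Nullary using (Dec; yes; no)
open import Relation.Nullary.Decidable using (⌊_⌋)

data Side : Set where
  X Y : Side

_≟S_ : (a b : Side) → Dec (a ≡ b)
X ≟S X = yes refl
X ≟S Y = no λ ()
Y ≟S X = no λ ()
Y ≟S Y = yes refl

-- Vertices of Pr_r: (X , i) is x_i and (Y , i) is y_i.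
Vertex : ℕ → Set
Vertex r = Side × Fin r

_≟V_ : ∀ {r} (u v : Vertex r) → Dec (u ≡ v)
_≟V_ = ≡-dec _≟S_ FinP._≟_

module Prism (r : ℕ) .{{_ : NonZero r}} where

  ι : ℕ → Fin r
  ι n = n mod r

  xv yv : ℕ → Vertex r
  xv n = X , ι n
  yv n = Y , ι n

  -- Edges of Pr_r:  xx i = x_i x_{i+1},  yy i = y_i y_{i+1},  xy i = x_i y_i.
  data Edge : Set where
    xx yy xy : Fin r → Edge

  ends : Edge → Vertex r × Vertex r
  ends (xx i) = (X , i) , xv (Data.Fin.toℕ i + 1)
  ends (yy i) = (Y , i) , yv (Data.Fin.toℕ i + 1)
  ends (xy i) = (X , i) , (Y , i)

  isEdge : Vertex r → Vertex r → Edge → Bool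
  isEdge u v e with ends e
  ... | (a , b) = ⌊ ≡-dec _≟V_ _≟V_ (u , v) (a , b) ⌋
               Data.Bool.∨ ⌊ ≡-dec _≟V_ _≟V_ (v , u) (a , b) ⌋

  -- 1-chains over Z/2: functions Edge → Bool, addition is pointwise xor
  Chain : Set
  Chain = Edge → Bool

  infixr 20 _⊕_
  _⊕_ : Chain → Chain → Chain
  (c ⊕ d) e = c e xor d e

  zeroC : Chain
  zeroC _ = false

  -- consecutive pairs of a circuit v_0 v_1 ... v_{l-1} v_0 (closing edge v_{l-1}v_0)
  pairs : List (Vertex r) → List (Vertex r × Vertex r)
  pairs [] = []
  pairs (v ∷ vs) = go v (v ∷ vs)
    where
    go : Vertex r → List (Vertex r) → List (Vertex r × Vertex r)
    go v₀ [] = []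
    go v₀ (a ∷ []) = (a , v₀) ∷ []
    go v₀ (a ∷ b ∷ rest) = (a , b) ∷ go v₀ (b ∷ rest)

  -- c_C : the Z/2 1-chain of the circuit C (given by its vertex sequence);
  -- its value on e is the parity of the number of traversals of e, which for a
  -- circuit (no repeated edges) is exactly membership of e in the edge set.
  chain : List (Vertex r) → Chain
  chain vs e = foldr (λ p acc → (isEdge (Data.Product.proj₁ p) (Data.Product.proj₂ p) e) xor acc)
                     false (pairs vs)

  -- H_{w,1} = x0 x1 y1 y2 x2 x3 ... x_{r-1} y_{r-1} y_0 x_0
  Hw1 : List (Vertex r)
  Hw1 = concatMap (λ j → xv (2 * j) ∷ xv (2 * j + 1) ∷ yv (2 * j + 1) ∷ yv (2 * j + 2) ∷ [])
                  (upTo (r Data.Nat./ 2))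

  -- H_{w,2} = y0 y1 x1 x2 y2 y3 ... y_{r-1} x_{r-1} x_0 y_0
  Hw2 : List (Vertex r)
  Hw2 = concatMap (λ j → yv (2 * j) ∷ yv (2 * j + 1) ∷ xv (2 * j + 1) ∷ xv (2 * j + 2) ∷ [])
                  (upTo (r Data.Nat./ 2))

  H : ℕ → List (Vertex r)
  H i = map (λ k → xv (i + k)) (upTo r) ++ reverse (map (λ k → yv (i + k)) (upTo r))

  Cr1 Cr2 : List (Vertex r)
  Cr1 = map xv (upTo r)
  Cr2 = map yv (upTo r)

  C4 : ℕ → List (Vertex r)
  C4 i = xv i ∷ xv (i + 1) ∷ yv (i + 1) ∷ yv i ∷ []

  SigmaH : Chain
  SigmaH = foldr (λ i acc → chain (H (2 * i)) ⊕ acc) zeroC (upTo (r Data.Nat./ 2))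

{-# OPTIONS --safe #-}

-- Over ℤ/2 a 1-chain is a function from edges to Bool, so every identity is checked edge
-- by edge. Following the vertex list of a circuit writes its chain as a xor-sum of
-- elementary edge chains (for r ≥ 3 two consecutive vertices determine their edge), and
-- since r consecutive indices meet every residue mod r exactly once these sums can be
-- evaluated: H_i contains every rail edge except the two of index i - 1, and the rungs
-- at i - 1 and i; H_{w,1} contains the x-rail edges of even index, the y-rail edges of
-- odd index and every rung, and H_{w,2} likewise with the sides exchanged; Σ contains
-- every rung, and a rail edge of index t iff exactly one of r/2 and t is odd. Comparing
-- these values gives the three identities, the two cases mod 4 being the parity of r/2.

module Submission where

open import Defs
open import Data.Nat using (ℕ; _+_; _≤_; _%_; NonZero)
open import Data.Nat.Divisibility using (_∣_)
open import Data.Fin using (Fin; toℕ)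
open import Data.Product using (_×_)
open import Relation.Binary.PropositionalEquality using (_≡_)

open import Data.Bool using (Bool; true; false; not; _∨_; _xor_; if_then_else_)
open import Data.Bool.Properties using (xor-assoc; xor-comm; xor-identityʳ; xor-inverseʳ; not-involutive; ∨-comm)
open import Data.Bool.Solver using (module xor-∧-Solver)
open import Data.Empty using (⊥-elim)
open import Data.Fin.Properties using (toℕ-injective; toℕ-fromℕ<; toℕ<n) renaming (_≟_ to _≟ᶠ_)
open import Data.List using (List; []; _∷_; _++_; [_]; take; drop; map; upTo; reverse; foldr; applyUpTo; applyDownFrom; concatMap)
open import Data.List.Properties using (++-assoc; map-upTo; reverse-applyUpTo)
open import Data.Nat using (zero; suc; _*_; _<_; z≤n; s≤s)
open import Data.Nat.Divisibility using (divides; ∣⇒≤)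
open import Data.Nat.DivMod
  using (_/_; m/n*n≡m; m*[n/m]≡n; m≡m%n+[m/n]*n; %-distribˡ-+; m%n%n≡m%n; m<n⇒m%n≡m; [m+n]%n≡m%n; n%n≡0; m%n*o≡m*o%[n*o])
open import Data.Nat.Properties using (+-suc; +-comm; +-assoc; +-identityʳ; +-cancelˡ-≡; *-suc; <⇒≱; suc-injective; *-cancelʳ-≡)
open import Data.Nat.Tactic.RingSolver using (solve-∀)
open import Data.Product using (_,_; proj₁; proj₂; uncurry; swap)
open import Data.Product.Properties using (≡-dec)
open import Function using (id; _∘_)
open import Relation.Binary.Definitions using (DecidableEquality)
open import Relation.Binary.PropositionalEquality using (_≢_; refl; sym; trans; cong; cong₂; _≗_; module ≡-Reasoning)
open import Relation.Nullary using (Dec; yes; no; ¬_)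
open import Relation.Nullary.Decidable using (⌊_⌋; does; map′; dec-true; dec-false)

open ≡-Reasoning
open xor-∧-Solver using (solve; _:=_; _:+_; con)

private
  variable
    A : Set

xor-cancelˡ : ∀ x y → x xor (x xor y) ≡ y
xor-cancelˡ = solve 2 (λ x y → x :+ (x :+ y) := y) refl

xor-interchange : ∀ a b c d → (a xor b) xor (c xor d) ≡ (a xor c) xor (b xor d)
xor-interchange = solve 4 (λ a b c d → (a :+ b) :+ (c :+ d) := (a :+ c) :+ (b :+ d)) refl

xor≡true⇒≡not : ∀ {x y} → x xor y ≡ true → x ≡ not y
xor≡true⇒≡not {x} {y} eq = begin
  x               ≡⟨ solve 2 (λ x y → x := (x :+ y) :+ y) refl x y ⟩
  (x xor y) xor y ≡⟨ cong (_xor y) eq ⟩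
  not y           ∎

⌊⌋-true : (a? : Dec A) → A → ⌊ a? ⌋ ≡ true
⌊⌋-true (yes _) _ = refl
⌊⌋-true (no ¬a) a = ⊥-elim (¬a a)

⌊⌋-false : (a? : Dec A) → ¬ A → ⌊ a? ⌋ ≡ false
⌊⌋-false (yes a) ¬a = ⊥-elim (¬a a)
⌊⌋-false (no _)  _  = refl

-- Finite xor-sums

⨁ : ℕ → (ℕ → Bool) → Bool
⨁ zero    f = false
⨁ (suc n) f = f 0 xor ⨁ n (f ∘ suc)

syntax ⨁ n (λ k → b) = ⨁[ k < n ] b

⨁-cong : ∀ n {f g : ℕ → Bool} → (∀ k → k < n → f k ≡ g k) → ⨁ n f ≡ ⨁ n g
⨁-cong zero    eq = refl
⨁-cong (suc n) eq = cong₂ _xor_ (eq 0 (s≤s z≤n)) (⨁-cong n (λ k k<n → eq (suc k) (s≤s k<n)))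

⨁-snoc : ∀ n f → ⨁ (suc n) f ≡ ⨁ n f xor f n
⨁-snoc zero    f = xor-identityʳ (f 0)
⨁-snoc (suc n) f = trans (cong (f 0 xor_) (⨁-snoc n (f ∘ suc))) (sym (xor-assoc (f 0) _ _))

⨁-xor : ∀ n f g → ⨁[ k < n ] (f k xor g k) ≡ ⨁ n f xor ⨁ n g
⨁-xor zero    f g = refl
⨁-xor (suc n) f g = trans (cong ((f 0 xor g 0) xor_) (⨁-xor n (f ∘ suc) (g ∘ suc)))
                          (xor-interchange (f 0) (g 0) (⨁ n (f ∘ suc)) (⨁ n (g ∘ suc)))

⨁-false : ∀ n → ⨁[ k < n ] false ≡ false
⨁-false zero    = refl
⨁-false (suc n) = ⨁-false n

⨁-true-%2 : ∀ q → ⨁[ k < q ] true ≡ ⨁[ k < q % 2 ] true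
⨁-true-%2 zero          = refl
⨁-true-%2 (suc zero)    = refl
⨁-true-%2 (suc (suc q)) = trans (not-involutive _) (⨁-true-%2 q)

⨁-unique : ∀ n f k₀ → k₀ < n → f k₀ ≡ true → (∀ k → k < n → k ≢ k₀ → f k ≡ false) → ⨁ n f ≡ true
⨁-unique (suc n) f zero _ f0 others =
  cong₂ _xor_ f0 (trans (⨁-cong n (λ k k<n → others (suc k) (s≤s k<n) λ ())) (⨁-false n))
⨁-unique (suc n) f (suc k₀) (s≤s k₀<n) fk₀ others =
  cong₂ _xor_ (others 0 (s≤s z≤n) λ ())
              (⨁-unique n (f ∘ suc) k₀ k₀<n fk₀ (λ k k<n k≢k₀ → others (suc k) (s≤s k<n) (k≢k₀ ∘ suc-injective)))

⨁-interleave : ∀ m f → ⨁[ j < m ] (f (2 * j) xor f (2 * j + 1)) ≡ ⨁ (m * 2) f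
⨁-interleave zero    f = refl
⨁-interleave (suc m) f = begin
  (f 0 xor f 1) xor ⨁[ j < m ] (f (2 * suc j) xor f (2 * suc j + 1))
    ≡⟨ cong ((f 0 xor f 1) xor_) (⨁-cong m (λ j _ → cong₂ (λ a b → f a xor f b) (*-suc 2 j) (cong (_+ 1) (*-suc 2 j)))) ⟩
  (f 0 xor f 1) xor ⨁[ j < m ] (f (2 + 2 * j) xor f (2 + 2 * j + 1))
    ≡⟨ cong ((f 0 xor f 1) xor_) (⨁-interleave m (f ∘ suc ∘ suc)) ⟩
  (f 0 xor f 1) xor ⨁ (m * 2) (f ∘ suc ∘ suc)
    ≡⟨ xor-assoc (f 0) (f 1) _ ⟩
  ⨁ (suc m * 2) f ∎

⨁-rotate₁ : ∀ n f → f n ≡ f 0 → ⨁[ k < n ] f (suc k) ≡ ⨁ n f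
⨁-rotate₁ n f fn≡f0 = begin
  ⨁ n (f ∘ suc)                    ≡⟨ sym (xor-cancelˡ (f 0) _) ⟩
  f 0 xor ⨁ (suc n) f              ≡⟨ cong (f 0 xor_) (⨁-snoc n f) ⟩
  f 0 xor (⨁ n f xor f n)          ≡⟨ cong (λ b → f 0 xor (⨁ n f xor b)) fn≡f0 ⟩
  f 0 xor (⨁ n f xor f 0)          ≡⟨ solve 2 (λ a s → a :+ (s :+ a) := s) refl (f 0) (⨁ n f) ⟩
  ⨁ n f                            ∎

⨁-rotate : ∀ n f a → (∀ k → f (k + n) ≡ f k) → ⨁[ k < n ] f (a + k) ≡ ⨁ n f
⨁-rotate n f zero    periodic = refl
⨁-rotate n f (suc a) periodic = begin
  ⨁[ k < n ] f (suc a + k)   ≡⟨ ⨁-cong n (λ k _ → cong f (sym (+-suc a k))) ⟩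
  ⨁[ k < n ] f (a + suc k)   ≡⟨ ⨁-rotate₁ n (f ∘ (a +_)) (trans (periodic a) (cong f (sym (+-identityʳ a)))) ⟩
  ⨁[ k < n ] f (a + k)       ≡⟨ ⨁-rotate n f a periodic ⟩
  ⨁ n f                      ∎

[m%n+k]%n≡[m+k]%n : ∀ m k n .{{_ : NonZero n}} → (m % n + k) % n ≡ (m + k) % n
[m%n+k]%n≡[m+k]%n m k n = begin
  (m % n + k) % n           ≡⟨ %-distribˡ-+ (m % n) k n ⟩
  (m % n % n + k % n) % n   ≡⟨ cong (λ a → (a + k % n) % n) (m%n%n≡m%n m n) ⟩
  (m % n + k % n) % n       ≡⟨ sym (%-distribˡ-+ m k n) ⟩
  (m + k) % n               ∎

[m+k]%n≡m⇒n∣k : ∀ m k n .{{_ : NonZero n}} → (m + k) % n ≡ m → n ∣ k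
[m+k]%n≡m⇒n∣k m k n eq = divides ((m + k) / n) (+-cancelˡ-≡ m k _ (begin
  m + k                         ≡⟨ m≡m%n+[m/n]*n (m + k) n ⟩
  (m + k) % n + (m + k) / n * n ≡⟨ cong (_+ (m + k) / n * n) eq ⟩
  m + (m + k) / n * n           ∎))

-- Walks

walk : List A → List (A × A)
walk []           = []
walk (u ∷ [])     = []
walk (u ∷ v ∷ vs) = (u , v) ∷ walk (v ∷ vs)

walk-++ : ∀ (l m : List A) → walk (l ++ m) ≡ walk (l ++ take 1 m) ++ walk m
walk-++ []          []      = refl
walk-++ []          (v ∷ m) = refl
walk-++ (u ∷ [])    []      = refl
walk-++ (u ∷ [])    (v ∷ m) = refl
walk-++ (u ∷ v ∷ l) m       = cong ((u , v) ∷_) (walk-++ (v ∷ l) m)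

walk-applyUpTo : ∀ (g : ℕ → A) k m →
  walk (applyUpTo g (suc k) ++ m) ≡ applyUpTo (λ j → g j , g (suc j)) k ++ walk (g k ∷ m)
walk-applyUpTo g zero    m = refl
walk-applyUpTo g (suc k) m = cong ((g 0 , g 1) ∷_) (walk-applyUpTo (g ∘ suc) k m)

walk-applyDownFrom : ∀ (g : ℕ → A) k m →
  walk (applyDownFrom g (suc k) ++ m) ≡ applyDownFrom (λ j → g (suc j) , g j) k ++ walk (g 0 ∷ m)
walk-applyDownFrom g zero    m = refl
walk-applyDownFrom g (suc k) m = cong ((g (suc k) , g k) ∷_) (walk-applyDownFrom g k m)

take-concatMap : ∀ (p : ℕ → A) (T : ℕ → List A) f k →
  take 1 (concatMap (λ j → p j ∷ T j) (applyUpTo f k) ++ [ p (f k) ]) ≡ [ p (f 0) ]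
take-concatMap p T f zero    = refl
take-concatMap p T f (suc k) = refl

-- Chains of circuits in the prism Pr_(suc n)

module PrismChains (n : ℕ) where

  r : ℕ
  r = suc n

  open Prism r

  toℕ-ι : ∀ a → toℕ (ι a) ≡ a % r
  toℕ-ι a = toℕ-fromℕ< _

  ι-cong : ∀ a b → a % r ≡ b % r → ι a ≡ ι b
  ι-cong a b eq = toℕ-injective (trans (toℕ-ι a) (trans eq (sym (toℕ-ι b))))

  ι-toℕ : ∀ i → ι (toℕ i) ≡ i
  ι-toℕ i = toℕ-injective (trans (toℕ-ι (toℕ i)) (m<n⇒m%n≡m (toℕ<n i)))

  ι-periodic : ∀ a → ι (a + r) ≡ ι a
  ι-periodic a = ι-cong (a + r) a ([m+n]%n≡m%n a r)

  next : Fin r → Fin r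
  next i = ι (toℕ i + 1)

  next-ι : ∀ a → next (ι a) ≡ ι (a + 1)
  next-ι a = ι-cong (toℕ (ι a) + 1) (a + 1) (trans (cong (λ z → (z + 1) % r) (toℕ-ι a)) ([m%n+k]%n≡[m+k]%n a 1 r))

  δ : ℕ → Fin r → Bool
  δ a t = does (ι a ≟ᶠ t)

  δ-periodic : ∀ a t → δ (a + r) t ≡ δ a t
  δ-periodic a t = cong (λ i → does (i ≟ᶠ t)) (ι-periodic a)

  δ-+1+n : ∀ a t → δ (a + 1 + n) t ≡ δ a t
  δ-+1+n a t = trans (cong (λ k → δ k t) (+-assoc a 1 n)) (δ-periodic a t)

  ⨁-δ : ∀ a t → ⨁[ k < r ] δ (a + k) t ≡ true
  ⨁-δ a t = trans (⨁-rotate r (λ k → δ k t) a (λ k → δ-periodic k t))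
                  (⨁-unique r (λ k → δ k t) (toℕ t) (toℕ<n t) (dec-true (ι (toℕ t) ≟ᶠ t) (ι-toℕ t))
                     (λ k k<r k≢t → dec-false (ι k ≟ᶠ t) (λ ιk≡t → k≢t (begin
                        k          ≡⟨ sym (m<n⇒m%n≡m k<r) ⟩
                        k % r      ≡⟨ sym (toℕ-ι k) ⟩
                        toℕ (ι k)  ≡⟨ cong toℕ ιk≡t ⟩
                        toℕ t      ∎))))

  ⨁-δ-init : ∀ a t → ⨁[ k < n ] δ (a + k) t ≡ not (δ (a + n) t)
  ⨁-δ-init a t = xor≡true⇒≡not (trans (sym (⨁-snoc n (λ k → δ (a + k) t))) (⨁-δ a t))

  _≟E_ : DecidableEquality Edge
  xx i ≟E xx j = map′ (cong xx) (λ { refl → refl }) (i ≟ᶠ j)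
  xx _ ≟E yy _ = no λ ()
  xx _ ≟E xy _ = no λ ()
  yy _ ≟E xx _ = no λ ()
  yy i ≟E yy j = map′ (cong yy) (λ { refl → refl }) (i ≟ᶠ j)
  yy _ ≟E xy _ = no λ ()
  xy _ ≟E xx _ = no λ ()
  xy _ ≟E yy _ = no λ ()
  xy i ≟E xy j = map′ (cong xy) (λ { refl → refl }) (i ≟ᶠ j)

  edge : Edge → Chain
  edge e₀ e = does (e₀ ≟E e)

  ends-injective : ∀ {e e′} → ends e ≡ ends e′ → e ≡ e′
  ends-injective {xx i} {xx j} eq = cong (xx ∘ proj₂ ∘ proj₁) eq
  ends-injective {yy i} {yy j} eq = cong (yy ∘ proj₂ ∘ proj₁) eq
  ends-injective {xy i} {xy j} eq = cong (xy ∘ proj₂ ∘ proj₁) eq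
  ends-injective {xx _} {yy _} ()
  ends-injective {xx _} {xy _} ()
  ends-injective {yy _} {xx _} ()
  ends-injective {yy _} {xy _} ()
  ends-injective {xy _} {xx _} ()
  ends-injective {xy _} {yy _} ()

  _≟P_ : DecidableEquality (Vertex r × Vertex r)
  _≟P_ = ≡-dec _≟V_ _≟V_

  isEdge-sym : ∀ u v → isEdge u v ≗ isEdge v u
  isEdge-sym u v e = ∨-comm ⌊ (u , v) ≟P ends e ⌋ ⌊ (v , u) ≟P ends e ⌋

  -- `chain vs e` unfolds to `pairChain (pairs vs) e`.
  pairChain : List (Vertex r × Vertex r) → Chain
  pairChain ps e = foldr (λ p acc → isEdge (proj₁ p) (proj₂ p) e xor acc) false ps

  pairChain-++ : ∀ ps qs e → pairChain (ps ++ qs) e ≡ pairChain ps e xor pairChain qs e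
  pairChain-++ []             qs e = refl
  pairChain-++ ((u , v) ∷ ps) qs e =
    trans (cong (isEdge u v e xor_) (pairChain-++ ps qs e)) (sym (xor-assoc (isEdge u v e) _ _))

  pairChain-applyUpTo : ∀ h k e → pairChain (applyUpTo h k) e ≡ ⨁[ j < k ] uncurry isEdge (h j) e
  pairChain-applyUpTo h zero    e = refl
  pairChain-applyUpTo h (suc k) e = cong (uncurry isEdge (h 0) e xor_) (pairChain-applyUpTo (h ∘ suc) k e)

  pairChain-applyDownFrom : ∀ h k e → pairChain (applyDownFrom h k) e ≡ ⨁[ j < k ] uncurry isEdge (h j) e
  pairChain-applyDownFrom h zero    e = refl
  pairChain-applyDownFrom h (suc k) e = begin
    uncurry isEdge (h k) e xor pairChain (applyDownFrom h k) e
      ≡⟨ cong (uncurry isEdge (h k) e xor_) (pairChain-applyDownFrom h k e) ⟩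
    uncurry isEdge (h k) e xor ⨁[ j < k ] uncurry isEdge (h j) e
      ≡⟨ xor-comm (uncurry isEdge (h k) e) _ ⟩
    ⨁[ j < k ] uncurry isEdge (h j) e xor uncurry isEdge (h k) e
      ≡⟨ sym (⨁-snoc k (λ j → uncurry isEdge (h j) e)) ⟩
    ⨁[ j < suc k ] uncurry isEdge (h j) e ∎

  -- `drop 1 (pairs (v ∷ b ∷ l))` is the local helper of `pairs` applied to `b ∷ l`.
  pairs-closes : ∀ v a l → pairs (v ∷ a ∷ l) ≡ (v , a) ∷ walk (a ∷ l ++ [ v ])
  pairs-closes v a []      = refl
  pairs-closes v a (b ∷ l) = cong (λ ps → (v , a) ∷ (a , b) ∷ drop 1 ps) (pairs-closes v b l)

  chain-closes : ∀ vs → chain vs ≗ pairChain (walk (vs ++ take 1 vs))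
  chain-closes []           e = refl
  chain-closes (v ∷ [])     e = refl
  chain-closes (v ∷ a ∷ vs) e = cong (λ ps → pairChain ps e) (pairs-closes v a vs)

  chain-cycle : ∀ (g : ℕ → Vertex r) m → g m ≡ g 0 →
    ∀ e → chain (map g (upTo m)) e ≡ ⨁[ k < m ] isEdge (g k) (g (suc k)) e
  chain-cycle g zero    _     e = refl
  chain-cycle g (suc m) gm≡g0 e = begin
    chain (map g (upTo (suc m))) e
      ≡⟨ chain-closes (map g (upTo (suc m))) e ⟩
    pairChain (walk (map g (upTo (suc m)) ++ [ g 0 ])) e
      ≡⟨ cong₂ (λ vs w → pairChain (walk (vs ++ [ w ])) e) (map-upTo g (suc m)) (sym gm≡g0) ⟩
    pairChain (walk (applyUpTo g (suc m) ++ [ g (suc m) ])) e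
      ≡⟨ cong (λ ps → pairChain ps e) (walk-applyUpTo g m [ g (suc m) ]) ⟩
    pairChain (applyUpTo (λ j → g j , g (suc j)) m ++ [ (g m , g (suc m)) ]) e
      ≡⟨ pairChain-++ (applyUpTo (λ j → g j , g (suc j)) m) _ e ⟩
    pairChain (applyUpTo (λ j → g j , g (suc j)) m) e xor (isEdge (g m) (g (suc m)) e xor false)
      ≡⟨ cong₂ _xor_ (pairChain-applyUpTo _ m e) (xor-identityʳ _) ⟩
    ⨁[ k < m ] isEdge (g k) (g (suc k)) e xor isEdge (g m) (g (suc m)) e
      ≡⟨ sym (⨁-snoc m (λ k → isEdge (g k) (g (suc k)) e)) ⟩
    ⨁[ k < suc m ] isEdge (g k) (g (suc k)) e ∎

  pairChain-blocks : ∀ (p : ℕ → Vertex r) T f k e →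
    pairChain (walk (concatMap (λ j → p j ∷ T j) (applyUpTo f k) ++ [ p (f k) ])) e
      ≡ ⨁[ j < k ] pairChain (walk (p (f j) ∷ T (f j) ++ [ p (f (suc j)) ])) e
  pairChain-blocks p T f zero    e = refl
  pairChain-blocks p T f (suc k) e = begin
    pairChain (walk ((first ++ rest) ++ [ p (f (suc k)) ])) e
      ≡⟨ cong (λ vs → pairChain (walk vs) e) (++-assoc first rest [ p (f (suc k)) ]) ⟩
    pairChain (walk (first ++ tail)) e
      ≡⟨ cong (λ ps → pairChain ps e) (walk-++ first tail) ⟩
    pairChain (walk (first ++ take 1 tail) ++ walk tail) e
      ≡⟨ pairChain-++ (walk (first ++ take 1 tail)) (walk tail) e ⟩
    pairChain (walk (first ++ take 1 tail)) e xor pairChain (walk tail) e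
      ≡⟨ cong₂ _xor_ (cong (λ vs → pairChain (walk (first ++ vs)) e) (take-concatMap p T (f ∘ suc) k))
                     (pairChain-blocks p T (f ∘ suc) k e) ⟩
    ⨁[ j < suc k ] pairChain (walk (p (f j) ∷ T (f j) ++ [ p (f (suc j)) ])) e ∎
    where
    first rest tail : List (Vertex r)
    first = p (f 0) ∷ T (f 0)
    rest  = concatMap (λ j → p j ∷ T j) (applyUpTo (f ∘ suc) k)
    tail  = rest ++ [ p (f (suc k)) ]

  chain-blocks : ∀ (p : ℕ → Vertex r) T m → p m ≡ p 0 →
    ∀ e → chain (concatMap (λ j → p j ∷ T j) (upTo m)) e ≡ ⨁[ j < m ] pairChain (walk (p j ∷ T j ++ [ p (suc j) ])) e
  chain-blocks p T zero    _     e = refl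
  chain-blocks p T (suc m) pm≡p0 e = begin
    chain blocks e                               ≡⟨ chain-closes blocks e ⟩
    pairChain (walk (blocks ++ [ p 0 ])) e       ≡⟨ cong (λ v → pairChain (walk (blocks ++ [ v ])) e) (sym pm≡p0) ⟩
    pairChain (walk (blocks ++ [ p (suc m) ])) e ≡⟨ pairChain-blocks p T id (suc m) e ⟩
    ⨁[ j < suc m ] pairChain (walk (p j ∷ T j ++ [ p (suc j) ])) e ∎
    where
    blocks = concatMap (λ j → p j ∷ T j) (upTo (suc m))

  chain-ladder : ∀ (g h : ℕ → Vertex r) k e →
    chain (map g (upTo (suc k)) ++ reverse (map h (upTo (suc k)))) e
      ≡ ⨁[ j < k ] isEdge (g j) (g (suc j)) e
          xor (isEdge (g k) (h k) e xor (⨁[ j < k ] isEdge (h (suc j)) (h j) e xor isEdge (h 0) (g 0) e))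
  chain-ladder g h k e = begin
    chain ladder e
      ≡⟨ chain-closes ladder e ⟩
    pairChain (walk (ladder ++ [ g 0 ])) e
      ≡⟨ cong (λ vs → pairChain (walk vs) e) unfold-ladder ⟩
    pairChain (walk (applyUpTo g (suc k) ++ back)) e
      ≡⟨ cong (λ ps → pairChain ps e) (walk-applyUpTo g k back) ⟩
    pairChain (applyUpTo (λ j → g j , g (suc j)) k ++ (g k , h k) ∷ walk back) e
      ≡⟨ pairChain-++ (applyUpTo (λ j → g j , g (suc j)) k) _ e ⟩
    pairChain (applyUpTo (λ j → g j , g (suc j)) k) e xor (isEdge (g k) (h k) e xor pairChain (walk back) e)
      ≡⟨ cong₂ (λ a b → a xor (isEdge (g k) (h k) e xor b)) (pairChain-applyUpTo _ k e) back-chain ⟩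
    ⨁[ j < k ] isEdge (g j) (g (suc j)) e
      xor (isEdge (g k) (h k) e xor (⨁[ j < k ] isEdge (h (suc j)) (h j) e xor isEdge (h 0) (g 0) e)) ∎
    where
    ladder back : List (Vertex r)
    ladder = map g (upTo (suc k)) ++ reverse (map h (upTo (suc k)))
    back   = applyDownFrom h (suc k) ++ [ g 0 ]

    unfold-ladder : ladder ++ [ g 0 ] ≡ applyUpTo g (suc k) ++ back
    unfold-ladder = trans (++-assoc (map g (upTo (suc k))) _ [ g 0 ])
      (cong₂ (λ xs ys → xs ++ ys ++ [ g 0 ]) (map-upTo g (suc k))
             (trans (cong reverse (map-upTo h (suc k))) (reverse-applyUpTo h (suc k))))

    back-chain : pairChain (walk back) e ≡ ⨁[ j < k ] isEdge (h (suc j)) (h j) e xor isEdge (h 0) (g 0) e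
    back-chain = begin
      pairChain (walk back) e
        ≡⟨ cong (λ ps → pairChain ps e) (walk-applyDownFrom h k [ g 0 ]) ⟩
      pairChain (applyDownFrom (λ j → h (suc j) , h j) k ++ [ (h 0 , g 0) ]) e
        ≡⟨ pairChain-++ (applyDownFrom (λ j → h (suc j) , h j) k) _ e ⟩
      pairChain (applyDownFrom (λ j → h (suc j) , h j) k) e xor (isEdge (h 0) (g 0) e xor false)
        ≡⟨ cong₂ _xor_ (pairChain-applyDownFrom _ k e) (xor-identityʳ _) ⟩
      ⨁[ j < k ] isEdge (h (suc j)) (h j) e xor isEdge (h 0) (g 0) e ∎

  foldr-⊕ : ∀ (c : ℕ → Chain) f k e → foldr (λ i acc → c i ⊕ acc) zeroC (applyUpTo f k) e ≡ ⨁[ j < k ] c (f j) e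
  foldr-⊕ c f zero    e = refl
  foldr-⊕ c f (suc k) e = cong (c (f 0) e xor_) (foldr-⊕ c (f ∘ suc) k e)

  vtx : Side → ℕ → Vertex r
  vtx s a = s , ι a

  rail : Side → Fin r → Edge
  rail X = xx
  rail Y = yy

  opposite : Side → Side
  opposite X = Y
  opposite Y = X

  does-if-opposite : ∀ b s s′ → does ((if b then opposite s else s) ≟S s′) ≡ does (s ≟S s′) xor b
  does-if-opposite false s s′ = sym (xor-identityʳ _)
  does-if-opposite true  X X  = refl
  does-if-opposite true  X Y  = refl
  does-if-opposite true  Y X  = refl
  does-if-opposite true  Y Y  = refl

  railRung : (Side → Fin r → Bool) → (Fin r → Bool) → Chain
  railRung f g (xx t) = f X t
  railRung f g (yy t) = f Y t
  railRung f g (xy t) = g t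

  on-rail : ∀ {c f g} → c ≗ railRung f g → ∀ s t → c (rail s t) ≡ f s t
  on-rail c≗ X t = c≗ (xx t)
  on-rail c≗ Y t = c≗ (yy t)

  ≗-by-kind : ∀ {c c′ : Chain} → (∀ s t → c (rail s t) ≡ c′ (rail s t)) → (∀ t → c (xy t) ≡ c′ (xy t)) → c ≗ c′
  ≗-by-kind rails rungs (xx t) = rails X t
  ≗-by-kind rails rungs (yy t) = rails Y t
  ≗-by-kind rails rungs (xy t) = rungs t

  module _ (3≤r : 3 ≤ r) where

    next²≢id : ∀ i → next (next i) ≢ i
    next²≢id i next²i≡i = <⇒≱ 3≤r (∣⇒≤ ([m+k]%n≡m⇒n∣k (toℕ i) 2 r (begin
      (toℕ i + 2) % r               ≡⟨ cong (_% r) (sym (+-assoc (toℕ i) 1 1)) ⟩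
      (toℕ i + 1 + 1) % r           ≡⟨ sym ([m%n+k]%n≡[m+k]%n (toℕ i + 1) 1 r) ⟩
      ((toℕ i + 1) % r + 1) % r     ≡⟨ cong (λ z → (z + 1) % r) (sym (toℕ-ι (toℕ i + 1))) ⟩
      (toℕ (next i) + 1) % r        ≡⟨ sym (toℕ-ι (toℕ (next i) + 1)) ⟩
      toℕ (next (next i))           ≡⟨ cong toℕ next²i≡i ⟩
      toℕ i                         ∎)))

    -- For r = 2 this fails: xx 0 and xx 1 both join x₀ and x₁.
    ends≢swap∘ends : ∀ {e e′} → ends e ≢ swap (ends e′)
    ends≢swap∘ends {xx i} {xx j} eq =
      next²≢id i (trans (cong (next ∘ proj₂ ∘ proj₂) eq) (sym (cong (proj₂ ∘ proj₁) eq)))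
    ends≢swap∘ends {yy i} {yy j} eq =
      next²≢id i (trans (cong (next ∘ proj₂ ∘ proj₂) eq) (sym (cong (proj₂ ∘ proj₁) eq)))
    ends≢swap∘ends {xx _} {yy _} ()
    ends≢swap∘ends {xx _} {xy _} ()
    ends≢swap∘ends {yy _} {xx _} ()
    ends≢swap∘ends {yy _} {xy _} ()
    ends≢swap∘ends {xy _} {xx _} ()
    ends≢swap∘ends {xy _} {yy _} ()
    ends≢swap∘ends {xy _} {xy _} ()

    isEdge-ends : ∀ e₀ → uncurry isEdge (ends e₀) ≗ edge e₀
    isEdge-ends e₀ e with e₀ ≟E e
    ... | yes refl = cong (_∨ ⌊ swap (ends e₀) ≟P ends e₀ ⌋) (⌊⌋-true (ends e₀ ≟P ends e₀) refl)
    ... | no e₀≢e  = cong₂ _∨_ (⌊⌋-false (ends e₀ ≟P ends e) (e₀≢e ∘ ends-injective))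
                               (⌊⌋-false (swap (ends e₀) ≟P ends e) (ends≢swap∘ends {e} {e₀} ∘ sym))

    isEdge-rail : ∀ s a {b} → b ≡ suc a → isEdge (vtx s a) (vtx s b) ≗ edge (rail s (ι a))
    isEdge-rail X a refl e =
      trans (cong (λ i → isEdge (X , ι a) (X , i) e) (sym (trans (next-ι a) (cong ι (+-comm a 1)))))
            (isEdge-ends (xx (ι a)) e)
    isEdge-rail Y a refl e =
      trans (cong (λ i → isEdge (Y , ι a) (Y , i) e) (sym (trans (next-ι a) (cong ι (+-comm a 1)))))
            (isEdge-ends (yy (ι a)) e)

    isEdge-rail⁻ : ∀ s a {b} → b ≡ suc a → isEdge (vtx s b) (vtx s a) ≗ edge (rail s (ι a))
    isEdge-rail⁻ s a {b} eq e = trans (isEdge-sym (vtx s b) (vtx s a) e) (isEdge-rail s a eq e)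

    isEdge-rung : ∀ s a {b} → a ≡ b → isEdge (vtx s a) (vtx (opposite s) b) ≗ edge (xy (ι a))
    isEdge-rung X a refl e = isEdge-ends (xy (ι a)) e
    isEdge-rung Y a refl e = trans (isEdge-sym (Y , ι a) (X , ι a) e) (isEdge-ends (xy (ι a)) e)

    isEdge-rung⁻ : ∀ s a {b} → a ≡ b → isEdge (vtx (opposite s) a) (vtx s b) ≗ edge (xy (ι a))
    isEdge-rung⁻ s a refl e = trans (isEdge-sym (vtx (opposite s) a) (vtx s a) e) (isEdge-rung s a refl e)

    -- map (vtx X) (upTo r) is Cr1 and map (vtx Y) (upTo r) is Cr2.
    chain-rail-cycle : ∀ s → chain (map (vtx s) (upTo r)) ≗ railRung (λ s′ _ → does (s ≟S s′)) (λ _ → false)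
    chain-rail-cycle s e =
      trans (chain-cycle (vtx s) r (cong (s ,_) (ι-periodic 0)) e)
            (trans (⨁-cong r (λ k _ → isEdge-rail s k refl e)) (on-kinds s e))
      where
      on-kinds : ∀ s e → ⨁[ k < r ] edge (rail s (ι k)) e ≡ railRung (λ s′ _ → does (s ≟S s′)) (λ _ → false) e
      on-kinds X (xx t) = ⨁-δ 0 t
      on-kinds X (yy t) = ⨁-false r
      on-kinds X (xy t) = ⨁-false r
      on-kinds Y (xx t) = ⨁-false r
      on-kinds Y (yy t) = ⨁-δ 0 t
      on-kinds Y (xy t) = ⨁-false r

    chain-H : ∀ i → chain (H i) ≗ railRung (λ _ t → not (δ (i + n) t)) (λ t → δ (i + n) t xor δ i t)
    chain-H i e =
      trans (chain-ladder (λ k → xv (i + k)) (λ k → yv (i + k)) n e)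
            (trans (cong₂ _xor_ (⨁-cong n (λ j _ → isEdge-rail X (i + j) (+-suc i j) e))
                     (cong₂ _xor_ (isEdge-rung X (i + n) refl e)
                       (cong₂ _xor_ (⨁-cong n (λ j _ → isEdge-rail⁻ Y (i + j) (+-suc i j) e))
                                    (isEdge-rung⁻ X (i + 0) refl e))))
                   (on-kinds e))
      where
      on-kinds : ∀ e → ⨁[ j < n ] edge (xx (ι (i + j))) e
                         xor (edge (xy (ι (i + n))) e xor (⨁[ j < n ] edge (yy (ι (i + j))) e xor edge (xy (ι (i + 0))) e))
                       ≡ railRung (λ _ t → not (δ (i + n) t)) (λ t → δ (i + n) t xor δ i t) e
      on-kinds (xx t) = trans (cong (λ b → ⨁[ j < n ] δ (i + j) t xor (b xor false)) (⨁-false n))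
                              (trans (xor-identityʳ _) (⨁-δ-init i t))
      on-kinds (yy t) = trans (cong (λ b → b xor (⨁[ j < n ] δ (i + j) t xor false)) (⨁-false n))
                              (trans (xor-identityʳ _) (⨁-δ-init i t))
      on-kinds (xy t) = trans (cong₂ (λ b b′ → b xor (δ (i + n) t xor (b′ xor δ (i + 0) t))) (⨁-false n) (⨁-false n))
                              (cong (λ k → δ (i + n) t xor δ k t) (+-identityʳ i))

    chain-C4 : ∀ a → chain (C4 a) ≗ railRung (λ _ → δ a) (λ t → δ (a + 1) t xor δ a t)
    chain-C4 a e =
      trans (cong₂ _xor_ (isEdge-rail X a (+-comm a 1) e)
              (cong₂ _xor_ (isEdge-rung X (a + 1) refl e)
                (cong₂ _xor_ (isEdge-rail⁻ Y a (+-comm a 1) e)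
                             (cong (_xor false) (isEdge-rung⁻ X a refl e)))))
            (on-kinds e)
      where
      on-kinds : ∀ e → edge (xx (ι a)) e xor (edge (xy (ι (a + 1))) e xor (edge (yy (ι a)) e xor (edge (xy (ι a)) e xor false)))
                       ≡ railRung (λ _ → δ a) (λ t → δ (a + 1) t xor δ a t) e
      on-kinds (xx t) = xor-identityʳ (δ a t)
      on-kinds (yy t) = xor-identityʳ (δ a t)
      on-kinds (xy t) = cong (δ (a + 1) t xor_) (xor-identityʳ (δ a t))

    module EvenPrism (2∣r : 2 ∣ r) where

      m : ℕ
      m = r / 2

      isOdd : Fin r → Bool
      isOdd t = ⨁[ j < m ] δ (2 * j + 1) t

      ⨁-δ-2j : ∀ t → ⨁[ j < m ] δ (2 * j) t ≡ not (isOdd t)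
      ⨁-δ-2j t = xor≡true⇒≡not (begin
        ⨁[ j < m ] δ (2 * j) t xor isOdd t             ≡⟨ sym (⨁-xor m (λ j → δ (2 * j) t) (λ j → δ (2 * j + 1) t)) ⟩
        ⨁[ j < m ] (δ (2 * j) t xor δ (2 * j + 1) t)   ≡⟨ ⨁-interleave m (λ k → δ k t) ⟩
        ⨁[ k < m * 2 ] δ k t                           ≡⟨ cong (λ K → ⨁[ k < K ] δ k t) (m/n*n≡m 2∣r) ⟩
        ⨁[ k < r ] δ k t                               ≡⟨ ⨁-δ 0 t ⟩
        true                                           ∎)

      ⨁-δ-rotate : ∀ c t → ⨁[ j < m ] δ (2 * (1 + j) + c) t ≡ ⨁[ j < m ] δ (2 * j + c) t
      ⨁-δ-rotate c t = ⨁-rotate m (λ j → δ (2 * j + c) t) 1 λ j → begin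
        δ (2 * (j + m) + c) t     ≡⟨ cong (λ k → δ k t) (regroup j m c) ⟩
        δ (2 * j + c + 2 * m) t   ≡⟨ cong (λ k → δ (2 * j + c + k) t) (m*[n/m]≡n 2∣r) ⟩
        δ (2 * j + c + r) t       ≡⟨ δ-periodic (2 * j + c) t ⟩
        δ (2 * j + c) t           ∎
        where
        regroup : ∀ j m c → 2 * (j + m) + c ≡ 2 * j + c + 2 * m
        regroup = solve-∀

      ⨁-δ-2j+2 : ∀ t → ⨁[ j < m ] δ (2 * j + 2) t ≡ not (isOdd t)
      ⨁-δ-2j+2 t = begin
        ⨁[ j < m ] δ (2 * j + 2) t         ≡⟨ ⨁-cong m (λ j _ → cong (λ k → δ k t) (shift j)) ⟩
        ⨁[ j < m ] δ (2 * (1 + j) + 0) t   ≡⟨ ⨁-δ-rotate 0 t ⟩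
        ⨁[ j < m ] δ (2 * j + 0) t         ≡⟨ ⨁-cong m (λ j _ → cong (λ k → δ k t) (+-identityʳ (2 * j))) ⟩
        ⨁[ j < m ] δ (2 * j) t             ≡⟨ ⨁-δ-2j t ⟩
        not (isOdd t)                      ∎
        where
        shift : ∀ j → 2 * j + 2 ≡ 2 * (1 + j) + 0
        shift = solve-∀

      -- 2 j + n is 2 j - 1 modulo r.
      ⨁-δ-2j+n : ∀ t → ⨁[ j < m ] δ (2 * j + n) t ≡ isOdd t
      ⨁-δ-2j+n t = begin
        ⨁[ j < m ] δ (2 * j + n) t         ≡⟨ sym (⨁-δ-rotate n t) ⟩
        ⨁[ j < m ] δ (2 * (1 + j) + n) t   ≡⟨ ⨁-cong m (λ j _ → trans (cong (λ k → δ k t) (shift j n)) (δ-periodic (2 * j + 1) t)) ⟩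
        isOdd t                            ∎
        where
        shift : ∀ j n → 2 * (1 + j) + n ≡ 2 * j + 1 + suc n
        shift = solve-∀

      -- weave X is Hw1 and weave Y is Hw2.
      weave : Side → List (Vertex r)
      weave s = concatMap (λ j → vtx s (2 * j) ∷ vtx s (2 * j + 1)
                               ∷ vtx (opposite s) (2 * j + 1) ∷ vtx (opposite s) (2 * j + 2) ∷ [])
                          (upTo m)

      chain-weave-edges : ∀ s e → chain (weave s) e
        ≡ ⨁[ j < m ] (edge (rail s (ι (2 * j))) e xor (edge (xy (ι (2 * j + 1))) e
                       xor (edge (rail (opposite s) (ι (2 * j + 1))) e xor (edge (xy (ι (2 * j + 2))) e xor false))))
      chain-weave-edges s e =
        trans (chain-blocks (λ j → vtx s (2 * j))
                            (λ j → vtx s (2 * j + 1) ∷ vtx (opposite s) (2 * j + 1) ∷ vtx (opposite s) (2 * j + 2) ∷ [])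
                            m closes e)
              (⨁-cong m (λ j _ →
                cong₂ _xor_ (isEdge-rail s (2 * j) (+-comm (2 * j) 1) e)
                  (cong₂ _xor_ (isEdge-rung s (2 * j + 1) refl e)
                    (cong₂ _xor_ (isEdge-rail (opposite s) (2 * j + 1) (+-suc (2 * j) 1) e)
                                 (cong (_xor false) (isEdge-rung⁻ s (2 * j + 2) (2j+2≡2[1+j] j) e))))))
        where
        closes : vtx s (2 * m) ≡ vtx s 0
        closes = cong (s ,_) (ι-cong (2 * m) 0 (trans (cong (_% r) (m*[n/m]≡n 2∣r)) (n%n≡0 r)))
        2j+2≡2[1+j] : ∀ j → 2 * j + 2 ≡ 2 * suc j
        2j+2≡2[1+j] = solve-∀

      ⨁-weave-rungs : ∀ t → ⨁[ j < m ] (δ (2 * j + 1) t xor (δ (2 * j + 2) t xor false)) ≡ true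
      ⨁-weave-rungs t = begin
        ⨁[ j < m ] (δ (2 * j + 1) t xor (δ (2 * j + 2) t xor false))
          ≡⟨ ⨁-cong m (λ j _ → cong (δ (2 * j + 1) t xor_) (xor-identityʳ _)) ⟩
        ⨁[ j < m ] (δ (2 * j + 1) t xor δ (2 * j + 2) t)
          ≡⟨ ⨁-xor m (λ j → δ (2 * j + 1) t) (λ j → δ (2 * j + 2) t) ⟩
        isOdd t xor ⨁[ j < m ] δ (2 * j + 2) t
          ≡⟨ cong (isOdd t xor_) (⨁-δ-2j+2 t) ⟩
        isOdd t xor not (isOdd t)
          ≡⟨ xor-inverseʳ (isOdd t) ⟩
        true ∎

      chain-weave : ∀ s → chain (weave s) ≗ railRung (λ s′ t → does (s ≟S s′) xor isOdd t) (λ _ → true)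
      chain-weave X (xx t) = trans (chain-weave-edges X (xx t)) (trans (⨁-cong m (λ j _ → xor-identityʳ _)) (⨁-δ-2j t))
      chain-weave X (yy t) = trans (chain-weave-edges X (yy t)) (⨁-cong m (λ j _ → xor-identityʳ _))
      chain-weave Y (xx t) = trans (chain-weave-edges Y (xx t)) (⨁-cong m (λ j _ → xor-identityʳ _))
      chain-weave Y (yy t) = trans (chain-weave-edges Y (yy t)) (trans (⨁-cong m (λ j _ → xor-identityʳ _)) (⨁-δ-2j t))
      chain-weave X (xy t) = trans (chain-weave-edges X (xy t)) (⨁-weave-rungs t)
      chain-weave Y (xy t) = trans (chain-weave-edges Y (xy t)) (⨁-weave-rungs t)

      oddHalf : Bool
      oddHalf = ⨁[ j < m ] true

      SigmaH≗railRung : SigmaH ≗ railRung (λ _ t → oddHalf xor isOdd t) (λ _ → true)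
      SigmaH≗railRung e = trans (foldr-⊕ (λ i → chain (H (2 * i))) id m e)
                        (trans (⨁-cong m (λ j _ → chain-H (2 * j) e)) (on-kinds e))
        where
        rails : ∀ t → ⨁[ j < m ] not (δ (2 * j + n) t) ≡ oddHalf xor isOdd t
        rails t = trans (⨁-xor m (λ _ → true) (λ j → δ (2 * j + n) t)) (cong (oddHalf xor_) (⨁-δ-2j+n t))

        on-kinds : ∀ e → ⨁[ j < m ] railRung (λ _ t → not (δ (2 * j + n) t)) (λ t → δ (2 * j + n) t xor δ (2 * j) t) e
                         ≡ railRung (λ _ t → oddHalf xor isOdd t) (λ _ → true) e
        on-kinds (xx t) = rails t
        on-kinds (yy t) = rails t
        on-kinds (xy t) = trans (⨁-xor m (λ j → δ (2 * j + n) t) (λ j → δ (2 * j) t))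
                                (trans (cong₂ _xor_ (⨁-δ-2j+n t) (⨁-δ-2j t)) (xor-inverseʳ (isOdd t)))

      m%2*2≡r%4 : m % 2 * 2 ≡ r % 4
      m%2*2≡r%4 = trans (m%n*o≡m*o%[n*o] m 2 2) (cong (_% 4) (m/n*n≡m 2∣r))

      oddHalf≡false : r % 4 ≡ 0 → oddHalf ≡ false
      oddHalf≡false r%4≡0 = trans (⨁-true-%2 m) (cong (λ K → ⨁[ k < K ] true) (*-cancelʳ-≡ (m % 2) 0 2 (trans m%2*2≡r%4 r%4≡0)))

      oddHalf≡true : r % 4 ≡ 2 → oddHalf ≡ true
      oddHalf≡true r%4≡2 = trans (⨁-true-%2 m) (cong (λ K → ⨁[ k < K ] true) (*-cancelʳ-≡ (m % 2) 1 2 (trans m%2*2≡r%4 r%4≡2)))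

      C4-decomposition : ∀ a → chain (C4 a) ≗ chain Hw1 ⊕ chain Hw2 ⊕ chain (H (a + 1))
      C4-decomposition a (xx t) = begin
        chain (C4 a) (xx t)
          ≡⟨ chain-C4 a (xx t) ⟩
        δ a t
          ≡⟨ solve 2 (λ o d → d := (con true :+ o) :+ (o :+ (con true :+ d))) refl (isOdd t) (δ a t) ⟩
        not (isOdd t) xor (isOdd t xor not (δ a t))
          ≡⟨ sym (cong₂ _xor_ (chain-weave X (xx t))
                   (cong₂ _xor_ (chain-weave Y (xx t)) (trans (chain-H (a + 1) (xx t)) (cong not (δ-+1+n a t))))) ⟩
        (chain Hw1 ⊕ chain Hw2 ⊕ chain (H (a + 1))) (xx t) ∎
      C4-decomposition a (yy t) = begin
        chain (C4 a) (yy t)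
          ≡⟨ chain-C4 a (yy t) ⟩
        δ a t
          ≡⟨ solve 2 (λ o d → d := o :+ ((con true :+ o) :+ (con true :+ d))) refl (isOdd t) (δ a t) ⟩
        isOdd t xor (not (isOdd t) xor not (δ a t))
          ≡⟨ sym (cong₂ _xor_ (chain-weave X (yy t))
                   (cong₂ _xor_ (chain-weave Y (yy t)) (trans (chain-H (a + 1) (yy t)) (cong not (δ-+1+n a t))))) ⟩
        (chain Hw1 ⊕ chain Hw2 ⊕ chain (H (a + 1))) (yy t) ∎
      C4-decomposition a (xy t) = begin
        chain (C4 a) (xy t)
          ≡⟨ chain-C4 a (xy t) ⟩
        δ (a + 1) t xor δ a t
          ≡⟨ solve 2 (λ d d′ → d′ :+ d := con true :+ (con true :+ (d :+ d′))) refl (δ a t) (δ (a + 1) t) ⟩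
        true xor (true xor (δ a t xor δ (a + 1) t))
          ≡⟨ sym (cong₂ _xor_ (chain-weave X (xy t))
                   (cong₂ _xor_ (chain-weave Y (xy t)) (trans (chain-H (a + 1) (xy t)) (cong (_xor δ (a + 1) t) (δ-+1+n a t))))) ⟩
        (chain Hw1 ⊕ chain Hw2 ⊕ chain (H (a + 1))) (xy t) ∎

      rail-decomposition : ∀ {b} → oddHalf ≡ b → ∀ s →
        chain (map (vtx (if b then opposite s else s)) (upTo r)) ≗ chain (weave s) ⊕ SigmaH
      rail-decomposition {b} oddHalf≡b s = ≗-by-kind rails rungs
        where
        s″ : Side
        s″ = if b then opposite s else s

        rails : ∀ s′ t → chain (map (vtx s″) (upTo r)) (rail s′ t) ≡ (chain (weave s) ⊕ SigmaH) (rail s′ t)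
        rails s′ t = begin
          chain (map (vtx s″) (upTo r)) (rail s′ t)
            ≡⟨ on-rail (chain-rail-cycle s″) s′ t ⟩
          does (s″ ≟S s′)
            ≡⟨ does-if-opposite b s s′ ⟩
          does (s ≟S s′) xor b
            ≡⟨ solve 3 (λ c b o → c :+ b := (c :+ o) :+ (b :+ o)) refl (does (s ≟S s′)) b (isOdd t) ⟩
          (does (s ≟S s′) xor isOdd t) xor (b xor isOdd t)
            ≡⟨ sym (cong₂ _xor_ (on-rail (chain-weave s) s′ t) (trans (on-rail SigmaH≗railRung s′ t) (cong (_xor isOdd t) oddHalf≡b))) ⟩
          (chain (weave s) ⊕ SigmaH) (rail s′ t) ∎

        rungs : ∀ t → chain (map (vtx s″) (upTo r)) (xy t) ≡ (chain (weave s) ⊕ SigmaH) (xy t)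
        rungs t = trans (chain-rail-cycle s″ (xy t)) (sym (cong₂ _xor_ (chain-weave s (xy t)) (SigmaH≗railRung (xy t))))

lemma4p3 : (r : ℕ) .{{_ : NonZero r}} → 3 ≤ r → 2 ∣ r →
    let open Prism r in
    ((i : Fin r) (e : Edge) →
       chain (C4 (toℕ i)) e ≡ (chain Hw1 ⊕ chain Hw2 ⊕ chain (H (toℕ i + 1))) e)
    × (r % 4 ≡ 0 → (e : Edge) →
         (chain Cr1 e ≡ (chain Hw1 ⊕ SigmaH) e) × (chain Cr2 e ≡ (chain Hw2 ⊕ SigmaH) e))
    × (r % 4 ≡ 2 → (e : Edge) →
         (chain Cr1 e ≡ (chain Hw2 ⊕ SigmaH) e) × (chain Cr2 e ≡ (chain Hw1 ⊕ SigmaH) e))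
lemma4p3 zero    ()
lemma4p3 (suc n) 3≤r 2∣r =
    (λ i → C4-decomposition (toℕ i))
  , (λ r%4≡0 e → rail-decomposition (oddHalf≡false r%4≡0) X e , rail-decomposition (oddHalf≡false r%4≡0) Y e)
  , (λ r%4≡2 e → rail-decomposition (oddHalf≡true r%4≡2) Y e , rail-decomposition (oddHalf≡true r%4≡2) X e)
  where open PrismChains.EvenPrism n 3≤r 2∣r
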